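{- Let $\hat g\in\mathbb{R}[[t]]$ be even with $\hat g(0)\ne0$, let $\hat f_1,\hat f_2\in\mathbb{R}[[t]]$ be odd of order $1$, and let $\hat b=\hat b_0+\hat b_1t$ with real $\hat b_0,\hat b_1\ge0$. If the compressed double Riordan array $(\hat g;\hat f_1,\hat f_2)$ is totally positive, then the compressed double almost-Riordan array $(\hat b_0+\hat b_1t\,|\,\hat g;\hat f_1,\hat f_2)$ is totally positive.
   Context: The compressed double almost-Riordan array $(\hat b|\hat g;\hat f_1,\hat f_2)$ is the infinite lower triangular matrix whose $k$-th column has generating function $\hat b$ for $k=0$, $t\hat g(\hat f_1\hat f_2)^{\ell}$ for $k=2\ell+1$, and $t\hat g\hat f_1(\hat f_1\hat f_2)^{\ell}$ for $k=2\ell+2$. The compressed double Riordan array $(\hat g;\hat f_1,\hat f_2)$ is the infinite lower triangular matrix whose $k$-th column has generating function $\hat g(\hat f_1\hat f_2)^{\ell}$ for $k=2\ell$ and $\hat g\hat f_1(\hat f_1\hat f_2)^{\ell}$ for $k=2\ell+1$. A matrix is totally positive if all its minors are nonnegative. -}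

module Defs where

open import Level using (Level; suc; _⊔_)
open import Data.Nat as ℕ using (ℕ; zero; _∸_; _%_; _/_)
import Data.Nat.Base as NB
open import Data.Fin as Fin using (Fin; toℕ; punchIn)
open import Data.Product using (Σ; _×_)
open import Relation.Nullary using (¬_)
open import Relation.Binary.Structures using (IsTotalOrder)
open import Algebra.Bundles using (CommutativeRing)

record OrderedField (c ℓ₁ ℓ₂ : Level) : Set (Level.suc (c ⊔ ℓ₁ ⊔ ℓ₂)) where
  field
    commRing : CommutativeRing c ℓ₁
  open CommutativeRing commRing public
  field
    _≤_          : Carrier → Carrier → Set ℓ₂
    isTotalOrder : IsTotalOrder _≈_ _≤_
    +-monoʳ-≤    : ∀ {x y} z → x ≤ y → (x + z) ≤ (y + z)
    *-nonneg     : ∀ {x y} → 0# ≤ x → 0# ≤ y → 0# ≤ (x * y)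
    0≉1          : ¬ (0# ≈ 1#)
    inverse      : ∀ x → ¬ (x ≈ 0#) → Σ Carrier (λ y → (x * y) ≈ 1#)

module _ {c ℓ₁ ℓ₂} (F : OrderedField c ℓ₁ ℓ₂) where
  open OrderedField F

  sumF : ∀ {n} → (Fin n → Carrier) → Carrier
  sumF {zero}    f = 0#
  sumF {ℕ.suc n} f = f Fin.zero + sumF (λ i → f (Fin.suc i))

  PS : Set c
  PS = ℕ → Carrier

  t : PS
  t 1 = 1#
  t _ = 0#

  _⊛_ : PS → PS → PS
  (a ⊛ b) n = sumF {ℕ.suc n} (λ i → a (toℕ i) * b (n ∸ toℕ i))

  oneS : PS
  oneS 0 = 1#
  oneS _ = 0#

  _^ˢ_ : PS → ℕ → PS
  a ^ˢ zero    = oneS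
  a ^ˢ ℕ.suc k = a ⊛ (a ^ˢ k)

  linS : Carrier → Carrier → PS
  linS b₀ b₁ 0 = b₀
  linS b₀ b₁ 1 = b₁
  linS b₀ b₁ _ = 0#

  IsEven : PS → Set ℓ₁
  IsEven a = ∀ n → a (2 NB.* n NB.+ 1) ≈ 0#

  IsOdd : PS → Set ℓ₁
  IsOdd a = ∀ n → a (2 NB.* n) ≈ 0#

  HasOrder1 : PS → Set ℓ₁
  HasOrder1 a = (a 0 ≈ 0#) × ¬ (a 1 ≈ 0#)

  -- k-th column of the compressed double Riordan array (g; f1, f2):
  -- g (f1 f2)^ℓ for k = 2ℓ, g f1 (f1 f2)^ℓ for k = 2ℓ+1
  riordanColAux : PS → PS → PS → ℕ → ℕ → PS
  riordanColAux g f₁ f₂ zero    ℓ = g ⊛ ((f₁ ⊛ f₂) ^ˢ ℓ)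
  riordanColAux g f₁ f₂ (ℕ.suc _) ℓ = (g ⊛ f₁) ⊛ ((f₁ ⊛ f₂) ^ˢ ℓ)

  riordanCol : PS → PS → PS → ℕ → PS
  riordanCol g f₁ f₂ k = riordanColAux g f₁ f₂ (k % 2) (k / 2)

  compressedDoubleRiordan : PS → PS → PS → ℕ → ℕ → Carrier
  compressedDoubleRiordan g f₁ f₂ n k = riordanCol g f₁ f₂ k n

  -- k-th column of the compressed double almost-Riordan array (b | g; f1, f2):
  -- b for k = 0; t g (f1f2)^ℓ for k = 2ℓ+1; t g f1 (f1f2)^ℓ for k = 2ℓ+2
  almostCol : PS → PS → PS → PS → ℕ → PS
  almostCol b g f₁ f₂ zero      = b
  almostCol b g f₁ f₂ (ℕ.suc k) = t ⊛ riordanCol g f₁ f₂ k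

  compressedDoubleAlmostRiordan : PS → PS → PS → PS → ℕ → ℕ → Carrier
  compressedDoubleAlmostRiordan b g f₁ f₂ n k = almostCol b g f₁ f₂ k n

  altSign : ℕ → Carrier
  altSign zero      = 1#
  altSign (ℕ.suc n) = - altSign n

  det : ∀ {m} → (Fin m → Fin m → Carrier) → Carrier
  det {zero}    A = 1#
  det {ℕ.suc m} A =
    sumF (λ j → altSign (toℕ j) * (A Fin.zero j * det (λ i k → A (Fin.suc i) (punchIn j k))))

  StrictlyIncreasing : ∀ {m} → (Fin m → ℕ) → Set
  StrictlyIncreasing {m} r = ∀ (i j : Fin m) → i Fin.< j → r i ℕ.< r j

  TotallyPositive : (ℕ → ℕ → Carrier) → Set ℓ₂
  TotallyPositive M =
    ∀ (m : ℕ) (r s : Fin m → ℕ) → StrictlyIncreasing r → StrictlyIncreasing s →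
    0# ≤ det (λ i j → M (r i) (s j))

-- Column 0 of the almost-Riordan array is b₀ + b₁t and every later column is t times a column
-- of the Riordan array R, so the matrix is R bordered by the column (b₀, b₁, 0, 0, …) on the
-- left and a zero row on top.  A minor of such a bordered matrix either has a zero row or a
-- zero column, or is a minor of R, or (when it uses column 0 and row 0 or 1) expands along its
-- first row to b₀ or b₁ times a minor of R.
module Submission where

open import Defs
open import Relation.Nullary using (¬_; yes; no)
open import Data.Nat as ℕ using (ℕ; zero; suc; z≤n; s≤s; _∸_)
import Data.Nat.Properties as ℕP
open import Data.Fin as Fin using (Fin; toℕ; punchIn; punchOut)
import Data.Fin.Properties as FinP
open import Relation.Binary.PropositionalEquality as P using (_≡_)
open import Relation.Binary.Structures using (IsTotalOrder)
import Relation.Binary.Reasoning.Setoid as ≈-Reasoning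

module _ {c ℓ₁ ℓ₂} (F : OrderedField c ℓ₁ ℓ₂) where
  open OrderedField F hiding (zero)
  open IsTotalOrder isTotalOrder using (≲-respʳ-≈) renaming (refl to ≤-refl)

  Matrix : Set c
  Matrix = ℕ → ℕ → Carrier

  SquareMatrix : ℕ → Set c
  SquareMatrix m = Fin m → Fin m → Carrier

  increasing-head-≤ : ∀ {m n} {r : Fin (suc m) → ℕ} → StrictlyIncreasing F r →
                      r Fin.zero ≡ n → ∀ i → n ℕ.≤ r i
  increasing-head-≤ sr P.refl Fin.zero    = ℕP.≤-refl
  increasing-head-≤ sr P.refl (Fin.suc i) = ℕP.<⇒≤ (sr Fin.zero (Fin.suc i) (s≤s z≤n))

  increasing-head-< : ∀ {m n} {r : Fin (suc m) → ℕ} → StrictlyIncreasing F r →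
                      r Fin.zero ≡ n → ∀ i → n ℕ.< r (Fin.suc i)
  increasing-head-< sr P.refl i = sr Fin.zero (Fin.suc i) (s≤s z≤n)

  increasing-tail : ∀ {m} {r : Fin (suc m) → ℕ} → StrictlyIncreasing F r →
                    StrictlyIncreasing F (λ i → r (Fin.suc i))
  increasing-tail sr i j i<j = sr (Fin.suc i) (Fin.suc j) (s≤s i<j)

  increasing-pred : ∀ {m} {r : Fin m → ℕ} → (∀ i → 1 ℕ.≤ r i) → StrictlyIncreasing F r →
                    StrictlyIncreasing F (λ i → r i ∸ 1)
  increasing-pred pos sr i j i<j = ℕP.∸-monoˡ-< (sr i j i<j) (pos i)

  sumF-cong : ∀ {n} {f h : Fin n → Carrier} → (∀ i → f i ≈ h i) → sumF F f ≈ sumF F h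
  sumF-cong {zero}  f≈h = refl
  sumF-cong {suc n} f≈h = +-cong (f≈h Fin.zero) (sumF-cong (λ i → f≈h (Fin.suc i)))

  sumF-zero : ∀ {n} {f : Fin n → Carrier} → (∀ i → f i ≈ 0#) → sumF F f ≈ 0#
  sumF-zero {zero}  f≈0 = refl
  sumF-zero {suc n} f≈0 =
    trans (+-cong (f≈0 Fin.zero) (sumF-zero (λ i → f≈0 (Fin.suc i)))) (+-identityʳ 0#)

  sumF-head : ∀ {n} {f : Fin (suc n) → Carrier} → (∀ i → f (Fin.suc i) ≈ 0#) →
              sumF F f ≈ f Fin.zero
  sumF-head tail≈0 = trans (+-congˡ (sumF-zero tail≈0)) (+-identityʳ _)

  minor : ∀ {m} → SquareMatrix (suc m) → Fin (suc m) → SquareMatrix m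
  minor A j i k = A (Fin.suc i) (punchIn j k)

  laplaceTerm : ∀ {m} → SquareMatrix (suc m) → Fin (suc m) → Carrier
  laplaceTerm A j = altSign F (toℕ j) * (A Fin.zero j * det F (minor A j))

  laplaceTerm-zero : ∀ {m} (A : SquareMatrix (suc m)) j →
                     A Fin.zero j * det F (minor A j) ≈ 0# → laplaceTerm A j ≈ 0#
  laplaceTerm-zero A j eq = trans (*-congˡ eq) (zeroʳ _)

  det-cong : ∀ {m} {A B : SquareMatrix m} → (∀ i j → A i j ≈ B i j) → det F A ≈ det F B
  det-cong {zero}  A≈B = refl
  det-cong {suc m} {A} {B} A≈B = sumF-cong {f = laplaceTerm A} {h = laplaceTerm B} λ j →
    *-congˡ (*-cong (A≈B Fin.zero j) (det-cong (λ i k → A≈B (Fin.suc i) (punchIn j k))))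

  det-zeroFirstRow : ∀ {m} (A : SquareMatrix (suc m)) → (∀ j → A Fin.zero j ≈ 0#) → det F A ≈ 0#
  det-zeroFirstRow A row≈0 = sumF-zero {f = laplaceTerm A} λ j →
    laplaceTerm-zero A j (trans (*-congʳ (row≈0 j)) (zeroˡ _))

  det-zeroColumn : ∀ {m} (A : SquareMatrix m) (c : Fin m) → (∀ i → A i c ≈ 0#) → det F A ≈ 0#
  det-zeroColumn {suc m} A c col≈0 = sumF-zero {f = laplaceTerm A} term≈0
    where
    term≈0 : ∀ j → laplaceTerm A j ≈ 0#
    term≈0 j with j Fin.≟ c
    ... | yes P.refl = laplaceTerm-zero A j (trans (*-congʳ (col≈0 Fin.zero)) (zeroˡ _))
    ... | no j≢c     = laplaceTerm-zero A j (trans (*-congˡ minor≈0) (zeroʳ _))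
      where
      minor≈0 : det F (minor A j) ≈ 0#
      minor≈0 = det-zeroColumn (minor A j) (punchOut j≢c) λ i →
        P.subst (λ k → A (Fin.suc i) k ≈ 0#) (P.sym (FinP.punchIn-punchOut j≢c)) (col≈0 (Fin.suc i))

  det-expandFirstEntry : ∀ {m} (A : SquareMatrix (suc m)) →
    (∀ j → A Fin.zero (Fin.suc j) * det F (minor A (Fin.suc j)) ≈ 0#) →
    det F A ≈ A Fin.zero Fin.zero * det F (minor A Fin.zero)
  det-expandFirstEntry A rest≈0 =
    trans (sumF-head {f = laplaceTerm A} (λ j → laplaceTerm-zero A (Fin.suc j) (rest≈0 j))) (*-identityˡ _)

  det-upperRightZero : ∀ {m} (A : SquareMatrix (suc m)) → (∀ j → A Fin.zero (Fin.suc j) ≈ 0#) →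
    det F A ≈ A Fin.zero Fin.zero * det F (minor A Fin.zero)
  det-upperRightZero A row≈0 =
    det-expandFirstEntry A (λ j → trans (*-congʳ (row≈0 j)) (zeroˡ _))

  det-lowerLeftZero : ∀ {m} (A : SquareMatrix (suc m)) → (∀ i → A (Fin.suc i) Fin.zero ≈ 0#) →
    det F A ≈ A Fin.zero Fin.zero * det F (minor A Fin.zero)
  det-lowerLeftZero {zero}  A col≈0 = det-expandFirstEntry A (λ ())
  det-lowerLeftZero {suc m} A col≈0 = det-expandFirstEntry A λ j →
    trans (*-congˡ (det-zeroColumn (minor A (Fin.suc j)) Fin.zero col≈0)) (zeroʳ _)

  totallyPositive-resp : ∀ {M N : Matrix} → (∀ n k → M n k ≈ N n k) →
                         TotallyPositive F M → TotallyPositive F N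
  totallyPositive-resp M≈N tpM m r s sr ss =
    ≲-respʳ-≈ (det-cong (λ i j → M≈N (r i) (s j))) (tpM m r s sr ss)

  nonneg-of-≈0 : ∀ {x} → x ≈ 0# → 0# ≤ x
  nonneg-of-≈0 x≈0 = ≲-respʳ-≈ (sym x≈0) ≤-refl

  t⊛-zero : ∀ (a : PS F) → (_⊛_ F (t F) a) 0 ≈ 0#
  t⊛-zero a = trans (+-identityʳ _) (zeroˡ _)

  t⊛-suc : ∀ (a : PS F) n → (_⊛_ F (t F) a) (suc n) ≈ a n
  t⊛-suc a n = begin
    (_⊛_ F (t F) a) (suc n)  ≈⟨ +-cong (zeroˡ _) (+-cong (*-identityˡ _) (sumF-zero {n} (λ _ → zeroˡ _))) ⟩
    0# + (a n + 0#)          ≈⟨ trans (+-identityˡ _) (+-identityʳ _) ⟩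
    a n                      ∎
    where open ≈-Reasoning setoid

  linS-nonneg : ∀ {b₀ b₁} → 0# ≤ b₀ → 0# ≤ b₁ → ∀ n → 0# ≤ linS F b₀ b₁ n
  linS-nonneg b₀≥0 b₁≥0 zero          = b₀≥0
  linS-nonneg b₀≥0 b₁≥0 (suc zero)    = b₁≥0
  linS-nonneg b₀≥0 b₁≥0 (suc (suc n)) = ≤-refl

  border : PS F → Matrix → Matrix
  border b R n       zero    = b n
  border b R zero    (suc k) = 0#
  border b R (suc n) (suc k) = R n k

  module _ {b : PS F} {R : Matrix} where

    border-firstRow : ∀ {n k} → n ≡ 0 → 1 ℕ.≤ k → border b R n k ≈ 0#
    border-firstRow P.refl (s≤s _) = refl

    border-interior : ∀ {n k} → 1 ℕ.≤ n → 1 ℕ.≤ k → border b R n k ≡ R (n ∸ 1) (k ∸ 1)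
    border-interior (s≤s _) (s≤s _) = P.refl

    border-firstColumn-nonneg : (∀ n → 0# ≤ b n) → ∀ {n k} → k ≡ 0 → 0# ≤ border b R n k
    border-firstColumn-nonneg b≥0 {n} P.refl = b≥0 n

    border-firstColumn-zero : (∀ n → b (2 ℕ.+ n) ≈ 0#) → ∀ {n k} → 2 ℕ.≤ n → k ≡ 0 →
                              border b R n k ≈ 0#
    border-firstColumn-zero b≈0 {suc (suc n)} (s≤s (s≤s _)) P.refl = b≈0 n

    border-interiorMinor-nonneg : TotallyPositive F R → ∀ {m} {r s : Fin m → ℕ} →
      StrictlyIncreasing F r → StrictlyIncreasing F s → (∀ i → 1 ℕ.≤ r i) → (∀ j → 1 ℕ.≤ s j) →
      0# ≤ det F (λ i j → border b R (r i) (s j))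
    border-interiorMinor-nonneg tpR {m} {r} {s} sr ss r≥1 s≥1 =
      ≲-respʳ-≈ (det-cong (λ i j → reflexive (P.sym (border-interior (r≥1 i) (s≥1 j)))))
        (tpR m (λ i → r i ∸ 1) (λ j → s j ∸ 1) (increasing-pred r≥1 sr) (increasing-pred s≥1 ss))

    border-totallyPositive : TotallyPositive F R → (∀ n → 0# ≤ b n) → (∀ n → b (2 ℕ.+ n) ≈ 0#) →
                             TotallyPositive F (border b R)
    border-totallyPositive tpR b≥0 b≈0 zero r s sr ss = tpR zero r s sr ss
    border-totallyPositive tpR b≥0 b≈0 (suc m) r s sr ss =
      byCorner (r Fin.zero) (s Fin.zero) P.refl P.refl
      where
      A : SquareMatrix (suc m)
      A i j = border b R (r i) (s j)

      1≤r-tail : ∀ i → 1 ℕ.≤ r (Fin.suc i)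
      1≤r-tail i = ℕP.≤-trans (s≤s z≤n) (increasing-head-< sr P.refl i)

      1≤s-tail : ∀ j → 1 ℕ.≤ s (Fin.suc j)
      1≤s-tail j = ℕP.≤-trans (s≤s z≤n) (increasing-head-< ss P.refl j)

      tail-nonneg : 0# ≤ det F (minor A Fin.zero)
      tail-nonneg = border-interiorMinor-nonneg tpR (increasing-tail sr) (increasing-tail ss)
                      1≤r-tail 1≤s-tail

      byCorner : ∀ x y → r Fin.zero ≡ x → s Fin.zero ≡ y → 0# ≤ det F A
      byCorner zero zero r₀ s₀ =
        ≲-respʳ-≈ (sym (det-upperRightZero A (λ j → border-firstRow r₀ (1≤s-tail j))))
          (*-nonneg (border-firstColumn-nonneg b≥0 s₀) tail-nonneg)
      byCorner (suc zero) zero r₀ s₀ =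
        ≲-respʳ-≈ (sym (det-lowerLeftZero A (λ i →
            border-firstColumn-zero b≈0 (increasing-head-< sr r₀ i) s₀)))
          (*-nonneg (border-firstColumn-nonneg b≥0 s₀) tail-nonneg)
      byCorner (suc (suc _)) zero r₀ s₀ =
        nonneg-of-≈0 (det-zeroColumn A Fin.zero (λ i →
          border-firstColumn-zero b≈0 (ℕP.≤-trans (s≤s (s≤s z≤n)) (increasing-head-≤ sr r₀ i)) s₀))
      byCorner zero (suc _) r₀ s₀ =
        nonneg-of-≈0 (det-zeroFirstRow A (λ j →
          border-firstRow r₀ (ℕP.≤-trans (s≤s z≤n) (increasing-head-≤ ss s₀ j))))
      byCorner (suc _) (suc _) r₀ s₀ =
        border-interiorMinor-nonneg tpR sr ss
          (λ i → ℕP.≤-trans (s≤s z≤n) (increasing-head-≤ sr r₀ i))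
          (λ j → ℕP.≤-trans (s≤s z≤n) (increasing-head-≤ ss s₀ j))

  almostRiordan≈border : ∀ b g f₁ f₂ n k →
    compressedDoubleAlmostRiordan F b g f₁ f₂ n k ≈ border b (compressedDoubleRiordan F g f₁ f₂) n k
  almostRiordan≈border b g f₁ f₂ n       zero    = refl
  almostRiordan≈border b g f₁ f₂ zero    (suc k) = t⊛-zero (riordanCol F g f₁ f₂ k)
  almostRiordan≈border b g f₁ f₂ (suc n) (suc k) = t⊛-suc (riordanCol F g f₁ f₂ k) n

theorem5p6 : ∀ {c ℓ₁ ℓ₂} (F : OrderedField c ℓ₁ ℓ₂) →
    let open OrderedField F in
    ∀ (g f₁ f₂ : PS F) (b₀ b₁ : Carrier) →
    IsEven F g → ¬ (g 0 ≈ 0#) →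
    IsOdd F f₁ → HasOrder1 F f₁ →
    IsOdd F f₂ → HasOrder1 F f₂ →
    0# ≤ b₀ → 0# ≤ b₁ →
    TotallyPositive F (compressedDoubleRiordan F g f₁ f₂) →
    TotallyPositive F (compressedDoubleAlmostRiordan F (linS F b₀ b₁) g f₁ f₂)
theorem5p6 F g f₁ f₂ b₀ b₁ _ _ _ _ _ _ b₀≥0 b₁≥0 tpR =
  totallyPositive-resp F (λ n k → sym (almostRiordan≈border F (linS F b₀ b₁) g f₁ f₂ n k))
    (border-totallyPositive F tpR (linS-nonneg F b₀≥0 b₁≥0) (λ _ → refl))
  where open OrderedField F using (sym; refl)
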